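{- Let $m,n\ge 3$ be integers with $m$ odd, and suppose $m$ is a smallest odd integer $\ge 3$ such that $G_{m,n'}$ has a $3$-dynamic $4$-coloring for some integer $n'\ge3$. Let $f$ be a $3$-dynamic $4$-coloring of $G_{m,n}$ and write $x_{i,j}=f(i,j)$. Let $a=x_{1,1}$, $b=x_{1,2}$, $c=x_{2,1}$, $d=x_{2,2}$. Then: the colors $a,b,c,d$ are distinct; the color sequences along row 1, row 2, column 1 and column 2 are periodic with period 4, namely row 1 reads $a,b,c,d,a,b,c,d,\dots$, row 2 reads $c,d,a,b,c,d,a,b,\dots$, column 1 (from top to bottom) reads $a,c,b,d,a,c,b,d,\dots$, and column 2 reads $b,d,a,c,b,d,a,c,\dots$. Furthermore $n\equiv 2\pmod 4$, and $x_{i,n-1}=x_{i,1}$ and $x_{i,n}=x_{i,2}$ for all $i\in[m]$ (columns $n-1$ and $n$ are copies of columns 1 and 2).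
   Context: For positive integers $m,n$, the grid $G_{m,n}$ is the graph with vertex set $[m]\times[n]$ (where $[p]=\{1,\dots,p\}$) in which $(i,j)$ and $(i',j')$ are adjacent iff $|i-i'|+|j-j'|=1$; vertex $(i,j)$ is thought of as row $i$, column $j$. An $r$-dynamic $k$-coloring of a graph $G$ is a proper vertex coloring $f$ with at most $k$ colors such that $|f(N(v))|\ge\min\{r,d(v)\}$ for every vertex $v$, where $N(v)$ is the neighborhood and $d(v)$ the degree of $v$. -}

module Defs where

open import Data.Nat using (ℕ; suc; _+_; _∸_; _≤_; _<_; _⊓_; ∣_-_∣)
open import Data.Nat.Properties using (_≟_)
open import Data.Nat.DivMod using (_mod_)
open import Data.Fin using (Fin)
import Data.Fin as F
open import Data.List using (List; map; concatMap; upTo; filter; length; allFin)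
open import Data.List.Relation.Unary.Any using (any?)
open import Data.Vec using (Vec; lookup; _∷_; [])
open import Data.Product using (_×_; _,_; proj₁; proj₂; Σ)
open import Relation.Binary.PropositionalEquality using (_≡_; _≢_)

Vertex : Set
Vertex = ℕ × ℕ

InGrid : ℕ → ℕ → Vertex → Set
InGrid m n (i , j) = (1 ≤ i × i ≤ m) × (1 ≤ j × j ≤ n)

Adj : Vertex → Vertex → Set
Adj (i , j) (i' , j') = ∣ i - i' ∣ + ∣ j - j' ∣ ≡ 1

vertices : ℕ → ℕ → List Vertex
vertices m n = concatMap (λ i → map (λ j → (i , j)) (map suc (upTo n))) (map suc (upTo m))

nbhd : ℕ → ℕ → Vertex → List Vertex
nbhd m n (i , j) =
  filter (λ u → (∣ i - proj₁ u ∣ + ∣ j - proj₂ u ∣) ≟ 1) (vertices m n)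

degree : ℕ → ℕ → Vertex → ℕ
degree m n v = length (nbhd m n v)

Coloring : ℕ → Set
Coloring k = ℕ → ℕ → Fin k

col : ∀ {k} → Coloring k → Vertex → Fin k
col f (i , j) = f i j

numNbrColors : ∀ {k} → ℕ → ℕ → Coloring k → Vertex → ℕ
numNbrColors {k} m n f v =
  length (filter (λ c → any? (λ u → c F.≟ col f u) (nbhd m n v)) (allFin k))

IsProper : ∀ {k} → ℕ → ℕ → Coloring k → Set
IsProper m n f = ∀ u v → InGrid m n u → InGrid m n v → Adj u v → col f u ≢ col f v

IsDynamicColoring : (r k m n : ℕ) → Coloring k → Set
IsDynamicColoring r k m n f =
  IsProper m n f × (∀ v → InGrid m n v → r ⊓ degree m n v ≤ numNbrColors m n f v)

HasDynamicColoring : (r k m n : ℕ) → Set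
HasDynamicColoring r k m n = Σ (Coloring k) (IsDynamicColoring r k m n)

-- period-4 pattern p1,p2,p3,p4,p1,... evaluated at 1-based position t
cyc4 : ∀ {A : Set} → A → A → A → A → ℕ → A
cyc4 p q r s t = lookup (p ∷ q ∷ r ∷ s ∷ []) ((t ∸ 1) mod 4)

-- A vertex on the boundary of the grid has at most three neighbours, so a 3-dynamic
-- colouring gives them pairwise distinct colours. Along each side this makes every unit
-- square of the two outermost lines rainbow, which forces every column of these two lines
-- to reappear upside down two steps further on; so both lines are 4-periodic, determined
-- by the 2×2 square at a corner. Computing the colours of the two bottom-right corner
-- vertices once via the left and bottom sides and once via the top and right sides gives
-- two equations between a, b, c, d which, when m is odd, force n ≡ 2 (mod 4); then the
-- top-right square repeats the top-left one, so the right strip repeats the left strip.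

module Submission where

open import Defs
open import Data.Nat using (ℕ; zero; suc; _+_; _*_; _∸_; _≤_; _<_; _%_; _⊓_; ∣_-_∣; z≤n; s≤s; z<s; s≤s⁻¹; _≤?_)
open import Data.Nat.Properties
  using (≤-refl; ≤-trans; ≤-antisym; <⇒≤; <⇒≢; ≰⇒>; 1+n≰n; 1+n≢n; n<1+n; n≤1+n; m<n⇒m<1+n;
         ⊓-glb; +-comm; _≟_; ∣n-n∣≡0; ∣-∣-comm; ∣m-n∣≡0⇒m≡n; module ≤-Reasoning)
open import Data.Nat.DivMod using ([m+n]%n≡m%n; [m+kn]%n≡m%n)
open import Data.Nat.Divisibility using (_∣_; divides; ∣m∣n⇒∣m+n)
open import Data.Fin using (Fin)
import Data.Fin as F
open import Data.Fin.Properties using (injective⇒≤; fromℕ<-cong)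
open import Data.Vec using (_∷_; [])
import Data.Vec as Vec
open import Data.List using (List; []; _∷_; length; lookup; map; filter; allFin; upTo; concatMap)
open import Data.List.Properties using (length-tabulate)
open import Data.List.Relation.Unary.Any using (here; there; any?; index)
open import Data.List.Relation.Unary.Any.Properties using (lookup-index)
open import Data.List.Relation.Unary.All using (All; []; _∷_)
import Data.List.Relation.Unary.All as All
import Data.List.Relation.Unary.All.Properties as All
open import Data.List.Relation.Unary.AllPairs using ([]; _∷_)
open import Data.List.Relation.Unary.Unique.Propositional using (Unique)
import Data.List.Relation.Unary.Unique.Propositional.Properties as Unique
open import Data.List.Relation.Binary.Subset.Propositional using (_⊆_)
open import Data.List.Membership.Propositional using (_∈_; find; lose)
open import Data.List.Membership.Propositional.Properties
  using (∈-lookup; ∈-allFin; ∈-map⁺; ∈-map⁻; ∈-upTo⁺; ∈-upTo⁻; ∈-concatMap⁺; ∈-concatMap⁻; ∈-filter⁺; ∈-filter⁻)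
open import Data.Product using (_×_; _,_; proj₁; proj₂; ∃; swap)
open import Data.Sum using (_⊎_; inj₁; inj₂)
open import Function using (_∘_)
open import Relation.Nullary using (¬_; yes; no; contradiction)
open import Relation.Binary.PropositionalEquality
  using (_≡_; _≢_; refl; sym; trans; cong; cong₂; subst; module ≡-Reasoning)

module _ {a} {A : Set a} where

  lookup-injective : ∀ {xs : List A} → Unique xs → ∀ {i j} → lookup xs i ≡ lookup xs j → i ≡ j
  lookup-injective (_ ∷ _) {F.zero} {F.zero} _ = refl
  lookup-injective (x∉xs ∷ _) {F.zero} {F.suc j} eq = contradiction eq (All.lookup x∉xs (∈-lookup j))
  lookup-injective (x∉xs ∷ _) {F.suc i} {F.zero} eq = contradiction (sym eq) (All.lookup x∉xs (∈-lookup i))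
  lookup-injective (_ ∷ xs!) {F.suc i} {F.suc j} eq = cong F.suc (lookup-injective xs! eq)

  unique⊆⇒length≤ : ∀ {xs ys : List A} → Unique xs → xs ⊆ ys → length xs ≤ length ys
  unique⊆⇒length≤ {xs} {ys} xs! xs⊆ys = injective⇒≤ position-injective
    where
    position : Fin (length xs) → Fin (length ys)
    position i = index (xs⊆ys (∈-lookup i))

    position-injective : ∀ {i j} → position i ≡ position j → i ≡ j
    position-injective {i} {j} eq = lookup-injective xs! (begin
      lookup xs i          ≡⟨ lookup-index (xs⊆ys (∈-lookup i)) ⟩
      lookup ys (position i) ≡⟨ cong (lookup ys) eq ⟩
      lookup ys (position j) ≡⟨ lookup-index (xs⊆ys (∈-lookup j)) ⟨
      lookup xs j          ∎)
      where open ≡-Reasoning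

unique∧n≤length⇒∈ : ∀ {n} {xs : List (Fin n)} → Unique xs → n ≤ length xs → ∀ x → x ∈ xs
unique∧n≤length⇒∈ {n} {xs} xs! n≤∣xs∣ x with any? (x F.≟_) xs
... | yes x∈xs = x∈xs
... | no x∉xs = contradiction (≤-trans ∣x∷xs∣≤n n≤∣xs∣) 1+n≰n
  where
  ∣x∷xs∣≤n : suc (length xs) ≤ n
  ∣x∷xs∣≤n = subst (suc (length xs) ≤_) (length-tabulate (λ i → i))
               (unique⊆⇒length≤ (All.¬Any⇒All¬ xs x∉xs ∷ xs!) (λ {y} _ → ∈-allFin y))

-- (a , c), (b , d), (b′ , d′) are three consecutive columns of a two-row strip.
columns-swap : ∀ {a b c d b′ d′ : Fin 4} → Unique (a ∷ b ∷ c ∷ d ∷ []) →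
               Unique (b ∷ b′ ∷ d ∷ d′ ∷ []) → a ≢ b′ → b′ ≡ c × d′ ≡ a
columns-swap {a} {b} {c} {d} {b′} {d′} abcd!
             ((b≢b′ ∷ _ ∷ b≢d′ ∷ []) ∷ (b′≢d ∷ b′≢d′ ∷ []) ∷ (d≢d′ ∷ []) ∷ [] ∷ []) a≢b′ =
  b′≡c , d′≡a
  where
  b′≡c : b′ ≡ c
  b′≡c with unique∧n≤length⇒∈ abcd! ≤-refl b′
  ... | here b′≡a = contradiction (sym b′≡a) a≢b′
  ... | there (here b′≡b) = contradiction (sym b′≡b) b≢b′
  ... | there (there (here b′≡c)) = b′≡c
  ... | there (there (there (here b′≡d))) = contradiction b′≡d b′≢d

  d′≡a : d′ ≡ a
  d′≡a with unique∧n≤length⇒∈ abcd! ≤-refl d′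
  ... | here d′≡a = d′≡a
  ... | there (here d′≡b) = contradiction (sym d′≡b) b≢d′
  ... | there (there (here d′≡c)) = contradiction (trans b′≡c (sym d′≡c)) b′≢d′
  ... | there (there (there (here d′≡d))) = contradiction (sym d′≡d) d≢d′

cycle₄ : ∀ {a} {A : Set a} → A → A → A → A → ℕ → A
cycle₄ x y z w zero = x
cycle₄ x y z w (suc k) = cycle₄ y z w x k

cycle₄-cong : ∀ {a} {A : Set a} {x y z w x′ y′ z′ w′ : A} →
              x ≡ x′ → y ≡ y′ → z ≡ z′ → w ≡ w′ → ∀ k → cycle₄ x y z w k ≡ cycle₄ x′ y′ z′ w′ k
cycle₄-cong refl refl refl refl k = refl

cycle₄-period : ∀ {a} {A : Set a} (x y z w : A) {k} → 4 ∣ k → cycle₄ x y z w k ≡ x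
cycle₄-period x y z w (divides q refl) = go q
  where
  go : ∀ q → cycle₄ x y z w (q * 4) ≡ x
  go zero = refl
  go (suc q) = go q

cyc4≡cycle₄ : ∀ {A : Set} (x y z w : A) k → cyc4 x y z w (suc k) ≡ cycle₄ x y z w k
cyc4≡cycle₄ x y z w 0 = refl
cyc4≡cycle₄ x y z w 1 = refl
cyc4≡cycle₄ x y z w 2 = refl
cyc4≡cycle₄ x y z w 3 = refl
cyc4≡cycle₄ x y z w (suc (suc (suc (suc k)))) =
  trans (cong (Vec.lookup (x ∷ y ∷ z ∷ w ∷ []))
              (fromℕ<-cong _ _ (trans (cong (_% 4) (+-comm 4 k)) ([m+n]%n≡m%n k 4)) _ _))
        (cyc4≡cycle₄ x y z w k)

-- Grid adjacency and neighbourhoods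

data Adjacent : Vertex → Vertex → Set where
  right : ∀ {i j} → Adjacent (i , j) (i , suc j)
  left  : ∀ {i j} → Adjacent (i , suc j) (i , j)
  down  : ∀ {i j} → Adjacent (i , j) (suc i , j)
  up    : ∀ {i j} → Adjacent (suc i , j) (i , j)

∣n-1+n∣≡1 : ∀ n → ∣ n - suc n ∣ ≡ 1
∣n-1+n∣≡1 zero = refl
∣n-1+n∣≡1 (suc n) = ∣n-1+n∣≡1 n

∣1+n-n∣≡1 : ∀ n → ∣ suc n - n ∣ ≡ 1
∣1+n-n∣≡1 n = trans (∣-∣-comm (suc n) n) (∣n-1+n∣≡1 n)

∣m-n∣≡1 : ∀ m n → ∣ m - n ∣ ≡ 1 → n ≡ suc m ⊎ m ≡ suc n
∣m-n∣≡1 zero n eq = inj₁ eq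
∣m-n∣≡1 (suc m) zero eq = inj₂ eq
∣m-n∣≡1 (suc m) (suc n) eq with ∣m-n∣≡1 m n eq
... | inj₁ n≡1+m = inj₁ (cong suc n≡1+m)
... | inj₂ m≡1+n = inj₂ (cong suc m≡1+n)

Adjacent⇒Adj : ∀ {u v} → Adjacent u v → Adj u v
Adjacent⇒Adj {i , j} right = cong₂ _+_ (∣n-n∣≡0 i) (∣n-1+n∣≡1 j)
Adjacent⇒Adj {i , suc j} left = cong₂ _+_ (∣n-n∣≡0 i) (∣1+n-n∣≡1 j)
Adjacent⇒Adj {i , j} down = cong₂ _+_ (∣n-1+n∣≡1 i) (∣n-n∣≡0 j)
Adjacent⇒Adj {suc i , j} up = cong₂ _+_ (∣1+n-n∣≡1 i) (∣n-n∣≡0 j)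

Adj⇒Adjacent : ∀ {u v} → Adj u v → Adjacent u v
Adj⇒Adjacent {i , j} {i′ , j′} adj with ∣ i - i′ ∣ in ∣i-i′∣ | ∣ j - j′ ∣ in ∣j-j′∣
Adj⇒Adjacent {i , j} {i′ , j′} refl | 0 | 1
  with ∣m-n∣≡0⇒m≡n {i} {i′} ∣i-i′∣ | ∣m-n∣≡1 j j′ ∣j-j′∣
... | refl | inj₁ refl = right
... | refl | inj₂ refl = left
Adj⇒Adjacent {i , j} {i′ , j′} refl | 1 | 0
  with ∣m-n∣≡1 i i′ ∣i-i′∣ | ∣m-n∣≡0⇒m≡n {j} {j′} ∣j-j′∣
... | inj₁ refl | refl = down
... | inj₂ refl | refl = up
Adj⇒Adjacent () | 0 | 0
Adj⇒Adjacent () | 0 | suc (suc _)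
Adj⇒Adjacent () | 1 | suc _
Adj⇒Adjacent () | suc (suc _) | _

∈-vertices⁺ : ∀ {m n i j} → InGrid m n (i , j) → (i , j) ∈ vertices m n
∈-vertices⁺ {m} {n} {suc i} {suc j} ((_ , s≤s i≤m) , (_ , s≤s j≤n)) =
  ∈-concatMap⁺ (λ i → map (λ j → (i , j)) (map suc (upTo n)))
    (lose (∈-map⁺ suc (∈-upTo⁺ (s≤s i≤m)))
          (∈-map⁺ (suc i ,_) (∈-map⁺ suc (∈-upTo⁺ (s≤s j≤n)))))

∈-vertices⁻ : ∀ {m n i j} → (i , j) ∈ vertices m n → InGrid m n (i , j)
∈-vertices⁻ {m} {n} v∈
  with find (∈-concatMap⁻ (λ i → map (λ j → (i , j)) (map suc (upTo n))) {xs = map suc (upTo m)} v∈)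
... | _ , i∈ , v∈row with ∈-map⁻ suc i∈ | ∈-map⁻ (_ ,_) v∈row
... | _ , i∈upTo , refl | _ , j∈ , refl with ∈-map⁻ suc j∈
... | _ , j∈upTo , refl = (s≤s z≤n , ∈-upTo⁻ i∈upTo) , (s≤s z≤n , ∈-upTo⁻ j∈upTo)

∈-nbhd⁺ : ∀ {m n u v} → InGrid m n u → Adjacent v u → u ∈ nbhd m n v
∈-nbhd⁺ {v = i , j} u∈G v~u =
  ∈-filter⁺ (λ u → (∣ i - proj₁ u ∣ + ∣ j - proj₂ u ∣) ≟ 1) (∈-vertices⁺ u∈G) (Adjacent⇒Adj v~u)

∈-nbhd⁻ : ∀ {m n u v} → u ∈ nbhd m n v → InGrid m n u × Adjacent v u
∈-nbhd⁻ {m} {n} {v = i , j} u∈N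
  with ∈-filter⁻ (λ u → (∣ i - proj₁ u ∣ + ∣ j - proj₂ u ∣) ≟ 1) {xs = vertices m n} u∈N
... | u∈V , adj = ∈-vertices⁻ u∈V , Adj⇒Adjacent adj

record Neighbourhood (m n : ℕ) (v : Vertex) (us : List Vertex) : Set where
  field
    centre   : InGrid m n v
    distinct : Unique us
    members  : All (λ u → InGrid m n u × Adjacent v u) us
    complete : ∀ {u} → InGrid m n u → Adjacent v u → u ∈ us

transpose-InGrid : ∀ {m n u} → InGrid m n u → InGrid n m (swap u)
transpose-InGrid (i∈ , j∈) = j∈ , i∈

transpose-Adjacent : ∀ {u v} → Adjacent u v → Adjacent (swap u) (swap v)
transpose-Adjacent right = down
transpose-Adjacent left = up
transpose-Adjacent down = right
transpose-Adjacent up = left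

transpose-Neighbourhood : ∀ {m n v us} → Neighbourhood m n v us → Neighbourhood n m (swap v) (map swap us)
transpose-Neighbourhood N = record
  { centre = transpose-InGrid centre
  ; distinct = Unique.map⁺ (cong swap) distinct
  ; members = All.map⁺ (All.map (λ (u∈G , v~u) → transpose-InGrid u∈G , transpose-Adjacent v~u) members)
  ; complete = λ u∈G v~u → ∈-map⁺ swap (complete (transpose-InGrid u∈G) (transpose-Adjacent v~u))
  }
  where open Neighbourhood N

n≢2+n : ∀ n → n ≢ 2 + n
n≢2+n n = <⇒≢ (m<n⇒m<1+n (n<1+n n))

top-Neighbourhood : ∀ {m n j} → 2 ≤ m → 1 ≤ j → 2 + j ≤ n →
  Neighbourhood m n (1 , suc j) ((1 , j) ∷ (1 , 2 + j) ∷ (2 , suc j) ∷ [])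
top-Neighbourhood {j = j} 2≤m 1≤j 2+j≤n = record
  { centre = (z<s , 1≤m) , (z<s , 1+j≤n)
  ; distinct = ((n≢2+n j ∘ cong proj₂) ∷ (λ ()) ∷ []) ∷ ((λ ()) ∷ []) ∷ [] ∷ []
  ; members = (((z<s , 1≤m) , (1≤j , <⇒≤ 1+j≤n)) , left)
            ∷ (((z<s , 1≤m) , (z<s , 2+j≤n)) , right)
            ∷ (((z<s , 2≤m) , (z<s , 1+j≤n)) , down) ∷ []
  ; complete = λ { _ left → here refl
                 ; _ right → there (here refl)
                 ; _ down → there (there (here refl))
                 ; ((() , _) , _) up }
  }
  where
  1≤m = <⇒≤ 2≤m
  1+j≤n = <⇒≤ 2+j≤n

bottom-Neighbourhood : ∀ {m′ n j} → 1 ≤ m′ → 1 ≤ j → 2 + j ≤ n →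
  Neighbourhood (suc m′) n (suc m′ , suc j) ((suc m′ , j) ∷ (suc m′ , 2 + j) ∷ (m′ , suc j) ∷ [])
bottom-Neighbourhood {m′} {j = j} 1≤m′ 1≤j 2+j≤n = record
  { centre = (z<s , ≤-refl) , (z<s , 1+j≤n)
  ; distinct = ((n≢2+n j ∘ cong proj₂) ∷ (1+n≢n ∘ cong proj₁) ∷ [])
             ∷ ((1+n≢n ∘ cong proj₁) ∷ []) ∷ [] ∷ []
  ; members = (((z<s , ≤-refl) , (1≤j , <⇒≤ 1+j≤n)) , left)
            ∷ (((z<s , ≤-refl) , (z<s , 2+j≤n)) , right)
            ∷ (((1≤m′ , n≤1+n m′) , (z<s , 1+j≤n)) , up) ∷ []
  ; complete = λ { _ left → here refl
                 ; _ right → there (here refl)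
                 ; _ up → there (there (here refl))
                 ; ((_ , 2+m′≤1+m′) , _) down → contradiction 2+m′≤1+m′ 1+n≰n }
  }
  where
  1+j≤n = <⇒≤ 2+j≤n

top-left-Neighbourhood : ∀ {m n} → 2 ≤ m → 2 ≤ n → Neighbourhood m n (1 , 1) ((1 , 2) ∷ (2 , 1) ∷ [])
top-left-Neighbourhood 2≤m 2≤n = record
  { centre = (≤-refl , <⇒≤ 2≤m) , (≤-refl , <⇒≤ 2≤n)
  ; distinct = ((λ ()) ∷ []) ∷ [] ∷ []
  ; members = (((≤-refl , <⇒≤ 2≤m) , (z<s , 2≤n)) , right)
            ∷ (((z<s , 2≤m) , (≤-refl , <⇒≤ 2≤n)) , down) ∷ []
  ; complete = λ { _ right → here refl
                 ; _ down → there (here refl)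
                 ; (_ , (() , _)) left
                 ; ((() , _) , _) up }
  }

top-right-Neighbourhood : ∀ {m n′} → 2 ≤ m → 1 ≤ n′ →
  Neighbourhood m (suc n′) (1 , suc n′) ((1 , n′) ∷ (2 , suc n′) ∷ [])
top-right-Neighbourhood {n′ = n′} 2≤m 1≤n′ = record
  { centre = (≤-refl , <⇒≤ 2≤m) , (z<s , ≤-refl)
  ; distinct = ((λ ()) ∷ []) ∷ [] ∷ []
  ; members = (((≤-refl , <⇒≤ 2≤m) , (1≤n′ , n≤1+n n′)) , left)
            ∷ (((z<s , 2≤m) , (z<s , ≤-refl)) , down) ∷ []
  ; complete = λ { _ left → here refl
                 ; _ down → there (here refl)
                 ; (_ , (_ , 2+n′≤1+n′)) right → contradiction 2+n′≤1+n′ 1+n≰n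
                 ; ((() , _) , _) up }
  }

bottom-right-Neighbourhood : ∀ {m′ n′} → 1 ≤ m′ → 1 ≤ n′ →
  Neighbourhood (suc m′) (suc n′) (suc m′ , suc n′) ((suc m′ , n′) ∷ (m′ , suc n′) ∷ [])
bottom-right-Neighbourhood {m′} {n′} 1≤m′ 1≤n′ = record
  { centre = (z<s , ≤-refl) , (z<s , ≤-refl)
  ; distinct = ((1+n≢n ∘ cong proj₁) ∷ []) ∷ [] ∷ []
  ; members = (((z<s , ≤-refl) , (1≤n′ , n≤1+n n′)) , left)
            ∷ (((1≤m′ , n≤1+n m′) , (z<s , ≤-refl)) , up) ∷ []
  ; complete = λ { _ left → here refl
                 ; _ up → there (here refl)
                 ; (_ , (_ , 2+n′≤1+n′)) right → contradiction 2+n′≤1+n′ 1+n≰n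
                 ; ((_ , 2+m′≤1+m′) , _) down → contradiction 2+m′≤1+m′ 1+n≰n }
  }

-- Vertices of degree at most 3 see pairwise distinct colours

module _ {k m n} {f : Coloring k} (dyn : IsDynamicColoring 3 k m n f) where

  neighbourhood-colours : ∀ {v us cs} → Neighbourhood m n v us → length us ≤ 3 →
                          (∀ {u} → u ∈ us → col f u ∈ cs) → length us ≤ length cs
  neighbourhood-colours {v} {us} {cs} N ∣us∣≤3 us↦cs = begin
    length us            ≤⟨ ⊓-glb ∣us∣≤3 (unique⊆⇒length≤ distinct us⊆N) ⟩
    3 ⊓ degree m n v     ≤⟨ proj₂ dyn v centre ⟩
    numNbrColors m n f v ≤⟨ unique⊆⇒length≤ (Unique.filter⁺ present? (Unique.allFin⁺ k)) present⊆cs ⟩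
    length cs            ∎
    where
    open Neighbourhood N
    open ≤-Reasoning

    present? = λ c → any? (λ u → c F.≟ col f u) (nbhd m n v)

    us⊆N : us ⊆ nbhd m n v
    us⊆N u∈us = let u∈G , v~u = All.lookup members u∈us in ∈-nbhd⁺ u∈G v~u

    present⊆cs : filter present? (allFin k) ⊆ cs
    present⊆cs c∈ with find (proj₂ (∈-filter⁻ present? {xs = allFin k} c∈))
    ... | _ , u∈N , refl = let u∈G , v~u = ∈-nbhd⁻ u∈N in us↦cs (complete u∈G v~u)

  neighbours₂-distinct : ∀ {v u₁ u₂} → Neighbourhood m n v (u₁ ∷ u₂ ∷ []) → col f u₁ ≢ col f u₂
  neighbours₂-distinct N c₁≡c₂ = 1+n≰n (neighbourhood-colours N (s≤s (s≤s z≤n)) one-colour)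
    where
    one-colour : ∀ {u} → u ∈ _ → col f u ∈ col f _ ∷ []
    one-colour (here refl) = here refl
    one-colour (there (here refl)) = here (sym c₁≡c₂)

  neighbours₃-distinct : ∀ {v u₁ u₂ u₃} → Neighbourhood m n v (u₁ ∷ u₂ ∷ u₃ ∷ []) →
                         Unique (col f u₁ ∷ col f u₂ ∷ col f u₃ ∷ [])
  neighbours₃-distinct {u₁ = u₁} {u₂} {u₃} N =
    (c₁≢c₂ ∷ c₁≢c₃ ∷ []) ∷ (c₂≢c₃ ∷ []) ∷ [] ∷ []
    where
    two-colours : ∀ {x y} → ¬ (∀ {u} → u ∈ u₁ ∷ u₂ ∷ u₃ ∷ [] → col f u ∈ x ∷ y ∷ [])
    two-colours us↦xy = 1+n≰n (neighbourhood-colours N ≤-refl us↦xy)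

    c₁≢c₂ : col f u₁ ≢ col f u₂
    c₁≢c₂ eq = two-colours λ { (here refl) → here refl
                             ; (there (here refl)) → here (sym eq)
                             ; (there (there (here refl))) → there (here refl) }

    c₁≢c₃ : col f u₁ ≢ col f u₃
    c₁≢c₃ eq = two-colours λ { (here refl) → here refl
                             ; (there (here refl)) → there (here refl)
                             ; (there (there (here refl))) → here (sym eq) }

    c₂≢c₃ : col f u₂ ≢ col f u₃
    c₂≢c₃ eq = two-colours λ { (here refl) → here refl
                             ; (there (here refl)) → there (here refl)
                             ; (there (there (here refl))) → there (here (sym eq)) }

-- p is a side of the grid and q the parallel line next to it; side k says that the
-- three neighbours of the boundary vertex k + 1 have distinct colours.
record BoundaryStrip (N : ℕ) (p q : ℕ → Fin 4) : Set where
  field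
    rung         : ∀ k → 1 ≤ k → k ≤ N → p k ≢ q k
    rails        : ∀ k → 1 ≤ k → suc k ≤ N → p k ≢ p (suc k) × q k ≢ q (suc k)
    side         : ∀ k → 1 ≤ k → 2 + k ≤ N → Unique (p k ∷ p (2 + k) ∷ q (suc k) ∷ [])
    first-corner : p 2 ≢ q 1
    last-corner  : ∀ k → suc k ≡ N → p k ≢ q (suc k)

module _ {N p q} (S : BoundaryStrip N p q) where
  open BoundaryStrip S

  diagonal : ∀ k → 1 ≤ k → suc k ≤ N → p k ≢ q (suc k)
  diagonal k 1≤k 1+k≤N with 2 + k ≤? N
  ... | no 2+k≰N = last-corner k (≤-antisym 1+k≤N (s≤s⁻¹ (≰⇒> 2+k≰N)))
  ... | yes 2+k≤N with side k 1≤k 2+k≤N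
  ...   | (_ ∷ pk≢qk′ ∷ []) ∷ _ = pk≢qk′

  antidiagonal : ∀ k → 1 ≤ k → suc k ≤ N → p (suc k) ≢ q k
  antidiagonal (suc zero) _ _ = first-corner
  antidiagonal (suc (suc k)) _ 3+k≤N with side (suc k) z<s 3+k≤N
  ... | _ ∷ (pk′≢qk ∷ []) ∷ _ = pk′≢qk

  square-distinct : ∀ k → 1 ≤ k → suc k ≤ N → Unique (p k ∷ p (suc k) ∷ q k ∷ q (suc k) ∷ [])
  square-distinct k 1≤k 1+k≤N =
    (pk≢pk′ ∷ rung k 1≤k (<⇒≤ 1+k≤N) ∷ diagonal k 1≤k 1+k≤N ∷ [])
    ∷ (antidiagonal k 1≤k 1+k≤N ∷ rung (suc k) z<s 1+k≤N ∷ [])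
    ∷ (qk≢qk′ ∷ []) ∷ [] ∷ []
    where
    pk≢pk′ = proj₁ (rails k 1≤k 1+k≤N)
    qk≢qk′ = proj₂ (rails k 1≤k 1+k≤N)

  column-swap : ∀ k → 1 ≤ k → 2 + k ≤ N → p (2 + k) ≡ q k × q (2 + k) ≡ p k
  column-swap k 1≤k 2+k≤N with side k 1≤k 2+k≤N
  ... | (pk≢pk″ ∷ _) ∷ _ =
    columns-swap (square-distinct k 1≤k (<⇒≤ 2+k≤N)) (square-distinct (suc k) z<s 2+k≤N) pk≢pk″

  strip-periodic : ∀ k → suc k ≤ N →
    p (suc k) ≡ cycle₄ (p 1) (p 2) (q 1) (q 2) k × q (suc k) ≡ cycle₄ (q 1) (q 2) (p 1) (p 2) k
  strip-periodic zero _ = refl , refl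
  strip-periodic (suc zero) _ = refl , refl
  strip-periodic (suc (suc k)) 3+k≤N =
    let p≡q , q≡p = column-swap (suc k) z<s 3+k≤N
        pk , qk = strip-periodic k (<⇒≤ (<⇒≤ 3+k≤N))
    in trans p≡q qk , trans q≡p pk

  strip-cyc4 : ∀ j → 1 ≤ j → j ≤ N →
    p j ≡ cyc4 (p 1) (p 2) (q 1) (q 2) j × q j ≡ cyc4 (q 1) (q 2) (p 1) (p 2) j
  strip-cyc4 (suc k) _ 1+k≤N =
    let pk , qk = strip-periodic k 1+k≤N
    in trans pk (sym (cyc4≡cycle₄ _ _ _ _ k)) , trans qk (sym (cyc4≡cycle₄ _ _ _ _ k))

-- Closing the boundary cycle

-- The colour in row 2 + t, column 1 + k, as forced by the left strip and then the bottom strip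
-- of a grid whose top-left square is a b / c d.
colourAlongBottom : (a b c d : Fin 4) (t k : ℕ) → Fin 4
colourAlongBottom a b c d t = cycle₄ (cycle₄ a c b d (suc t)) (cycle₄ b d a c (suc t))
                                     (cycle₄ a c b d t) (cycle₄ b d a c t)

-- The colour in row 1 + k, column 2 + s, as forced by the top strip and then the right strip.
colourAlongRight : (a b c d : Fin 4) (s k : ℕ) → Fin 4
colourAlongRight a b c d s = cycle₄ (cycle₄ a b c d (suc s)) (cycle₄ c d a b (suc s))
                                    (cycle₄ a b c d s) (cycle₄ c d a b s)

-- Both sides depend only on t and s modulo 4, so this is a finite check.
corner-colours⇒4∣s : ∀ {a b c d} → Unique (a ∷ b ∷ c ∷ d ∷ []) → ∀ t s → ¬ 2 ∣ t →
  colourAlongBottom a b c d t (suc s) ≡ colourAlongRight a b c d s (suc t) →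
  colourAlongBottom a b c d t s ≡ colourAlongRight a b c d s (3 + t) → 4 ∣ s
corner-colours⇒4∣s {a} {b} {c} {d} ((_ ∷ _ ∷ _ ∷ []) ∷ (b≢c ∷ b≢d ∷ []) ∷ (c≢d ∷ []) ∷ [] ∷ []) = by-height
  where
  step : ∀ {s} → 4 ∣ s → 4 ∣ 4 + s
  step = ∣m∣n⇒∣m+n (divides 1 refl)

  height1 : ∀ s → colourAlongBottom a b c d 1 (suc s) ≡ colourAlongRight a b c d s 2 → 4 ∣ s
  height1 0 _ = divides 0 refl
  height1 1 eq = contradiction (sym eq) b≢c
  height1 2 eq = contradiction (sym eq) c≢d
  height1 3 eq = contradiction eq b≢d
  height1 (suc (suc (suc (suc s)))) eq = step (height1 s eq)

  height3 : ∀ s → colourAlongBottom a b c d 3 (suc s) ≡ colourAlongRight a b c d s 4 →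
            colourAlongBottom a b c d 3 s ≡ colourAlongRight a b c d s 6 → 4 ∣ s
  height3 0 _ _ = divides 0 refl
  height3 1 eq _ = contradiction (sym eq) c≢d
  height3 2 eq _ = contradiction eq c≢d
  height3 3 _ eq = contradiction eq c≢d
  height3 (suc (suc (suc (suc s)))) eq eq′ = step (height3 s eq eq′)

  by-height : ∀ t s → ¬ 2 ∣ t → _ → _ → 4 ∣ s
  by-height 0 s t-odd _ _ = contradiction (divides 0 refl) t-odd
  by-height 1 s _ eq _ = height1 s eq
  by-height 2 s t-odd _ _ = contradiction (divides 1 refl) t-odd
  by-height 3 s _ eq eq′ = height3 s eq eq′
  by-height (suc (suc (suc (suc t)))) s t-odd =
    by-height t s (t-odd ∘ ∣m∣n⇒∣m+n (divides 2 refl))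

module Grid {t s} {f : Coloring 4} (dyn : IsDynamicColoring 3 4 (2 + t) (2 + s) f) where

  private
    m′ = suc t
    n′ = suc s
    m = suc m′
    n = suc n′
    1≤m′ = z<s {t}
    1≤n′ = z<s {s}
    2≤m = s≤s 1≤m′
    2≤n = s≤s 1≤n′
    1≤m = <⇒≤ 2≤m
    1≤n = <⇒≤ 2≤n

    differ : ∀ {u v} → InGrid m n u → InGrid m n v → Adjacent u v → col f u ≢ col f v
    differ u∈G v∈G u~v = proj₁ dyn _ _ u∈G v∈G (Adjacent⇒Adj u~v)

    in-grid : ∀ {i j} → 1 ≤ i → i ≤ m → 1 ≤ j → j ≤ n → InGrid m n (i , j)
    in-grid 1≤i i≤m 1≤j j≤n = (1≤i , i≤m) , (1≤j , j≤n)

  top-strip : BoundaryStrip n (f 1) (f 2)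
  top-strip = record
    { rung = λ k 1≤k k≤n → differ (in-grid ≤-refl 1≤m 1≤k k≤n) (in-grid z<s 2≤m 1≤k k≤n) down
    ; rails = λ k 1≤k 1+k≤n →
        differ (in-grid ≤-refl 1≤m 1≤k (<⇒≤ 1+k≤n)) (in-grid ≤-refl 1≤m z<s 1+k≤n) right ,
        differ (in-grid z<s 2≤m 1≤k (<⇒≤ 1+k≤n)) (in-grid z<s 2≤m z<s 1+k≤n) right
    ; side = λ k 1≤k 2+k≤n → neighbours₃-distinct dyn (top-Neighbourhood 2≤m 1≤k 2+k≤n)
    ; first-corner = neighbours₂-distinct dyn (top-left-Neighbourhood 2≤m 2≤n)
    ; last-corner = λ { _ refl → neighbours₂-distinct dyn (top-right-Neighbourhood 2≤m 1≤n′) }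
    }

  left-strip : BoundaryStrip m (λ i → f i 1) (λ i → f i 2)
  left-strip = record
    { rung = λ k 1≤k k≤m → differ (in-grid 1≤k k≤m ≤-refl 1≤n) (in-grid 1≤k k≤m z<s 2≤n) right
    ; rails = λ k 1≤k 1+k≤m →
        differ (in-grid 1≤k (<⇒≤ 1+k≤m) ≤-refl 1≤n) (in-grid z<s 1+k≤m ≤-refl 1≤n) down ,
        differ (in-grid 1≤k (<⇒≤ 1+k≤m) z<s 2≤n) (in-grid z<s 1+k≤m z<s 2≤n) down
    ; side = λ k 1≤k 2+k≤m →
        neighbours₃-distinct dyn (transpose-Neighbourhood (top-Neighbourhood 2≤n 1≤k 2+k≤m))
    ; first-corner = neighbours₂-distinct dyn (transpose-Neighbourhood (top-left-Neighbourhood 2≤n 2≤m))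
    ; last-corner = λ { _ refl →
        neighbours₂-distinct dyn (transpose-Neighbourhood (top-right-Neighbourhood 2≤n 1≤m′)) }
    }

  right-strip : BoundaryStrip m (λ i → f i n) (λ i → f i n′)
  right-strip = record
    { rung = λ k 1≤k k≤m → differ (in-grid 1≤k k≤m z<s ≤-refl) (in-grid 1≤k k≤m 1≤n′ (n≤1+n n′)) left
    ; rails = λ k 1≤k 1+k≤m →
        differ (in-grid 1≤k (<⇒≤ 1+k≤m) z<s ≤-refl) (in-grid z<s 1+k≤m z<s ≤-refl) down ,
        differ (in-grid 1≤k (<⇒≤ 1+k≤m) 1≤n′ (n≤1+n n′)) (in-grid z<s 1+k≤m 1≤n′ (n≤1+n n′)) down
    ; side = λ k 1≤k 2+k≤m →
        neighbours₃-distinct dyn (transpose-Neighbourhood (bottom-Neighbourhood 1≤n′ 1≤k 2+k≤m))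
    ; first-corner = neighbours₂-distinct dyn (top-right-Neighbourhood 2≤m 1≤n′) ∘ sym
    ; last-corner = λ { _ refl → neighbours₂-distinct dyn (bottom-right-Neighbourhood 1≤m′ 1≤n′) ∘ sym }
    }

  bottom-strip : BoundaryStrip n (f m) (f m′)
  bottom-strip = record
    { rung = λ k 1≤k k≤n → differ (in-grid z<s ≤-refl 1≤k k≤n) (in-grid 1≤m′ (n≤1+n m′) 1≤k k≤n) up
    ; rails = λ k 1≤k 1+k≤n →
        differ (in-grid z<s ≤-refl 1≤k (<⇒≤ 1+k≤n)) (in-grid z<s ≤-refl z<s 1+k≤n) right ,
        differ (in-grid 1≤m′ (n≤1+n m′) 1≤k (<⇒≤ 1+k≤n)) (in-grid 1≤m′ (n≤1+n m′) z<s 1+k≤n) right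
    ; side = λ k 1≤k 2+k≤n → neighbours₃-distinct dyn (bottom-Neighbourhood 1≤m′ 1≤k 2+k≤n)
    ; first-corner = neighbours₂-distinct dyn (transpose-Neighbourhood (top-right-Neighbourhood 2≤n 1≤m′)) ∘ sym
    ; last-corner = λ { _ refl → neighbours₂-distinct dyn (bottom-right-Neighbourhood 1≤m′ 1≤n′) }
    }

  a = f 1 1
  b = f 1 2
  c = f 2 1
  d = f 2 2

  corner-square-distinct : Unique (a ∷ b ∷ c ∷ d ∷ [])
  corner-square-distinct = square-distinct top-strip 1 ≤-refl 2≤n

  private
    top-rows = strip-periodic top-strip
    left-columns = strip-periodic left-strip
    right-columns = strip-periodic right-strip
    bottom-rows = strip-periodic bottom-strip

    bottom-left : ∀ k → cycle₄ (f m 1) (f m 2) (f m′ 1) (f m′ 2) k ≡ colourAlongBottom a b c d t k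
    bottom-left = cycle₄-cong (proj₁ (left-columns m′ ≤-refl)) (proj₂ (left-columns m′ ≤-refl))
                              (proj₁ (left-columns t (n≤1+n m′))) (proj₂ (left-columns t (n≤1+n m′)))

    top-right : ∀ k → cycle₄ (f 1 n) (f 2 n) (f 1 n′) (f 2 n′) k ≡ colourAlongRight a b c d s k
    top-right = cycle₄-cong (proj₁ (top-rows n′ ≤-refl)) (proj₂ (top-rows n′ ≤-refl))
                            (proj₁ (top-rows s (n≤1+n n′))) (proj₂ (top-rows s (n≤1+n n′)))

  odd-height⇒4∣s : ¬ 2 ∣ t → 4 ∣ s
  odd-height⇒4∣s t-odd = corner-colours⇒4∣s corner-square-distinct t s t-odd
    (begin
      colourAlongBottom a b c d t n′ ≡⟨ bottom-left n′ ⟨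
      _                              ≡⟨ proj₁ (bottom-rows n′ ≤-refl) ⟨
      f m n                          ≡⟨ proj₁ (right-columns m′ ≤-refl) ⟩
      _                              ≡⟨ top-right m′ ⟩
      colourAlongRight a b c d s m′  ∎)
    (begin
      colourAlongBottom a b c d t s  ≡⟨ bottom-left s ⟨
      _                              ≡⟨ proj₁ (bottom-rows s (n≤1+n n′)) ⟨
      f m n′                         ≡⟨ proj₂ (right-columns m′ ≤-refl) ⟩
      _                              ≡⟨ top-right (2 + m′) ⟩
      colourAlongRight a b c d s (2 + m′) ∎)
    where open ≡-Reasoning

  4∣s⇒last-columns-copy : 4 ∣ s → ∀ i → 1 ≤ i → i ≤ m → f i n′ ≡ f i 1 × f i n ≡ f i 2
  4∣s⇒last-columns-copy 4∣s (suc k) _ 1+k≤m =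
    let right-p , right-q = right-columns k 1+k≤m
        left-p , left-q = left-columns k 1+k≤m
    in trans right-q (trans (top-right-square (2 + k)) (sym left-p))
     , trans right-p (trans (top-right-square k) (sym left-q))
    where
    top-right-square : ∀ k → cycle₄ (f 1 n) (f 2 n) (f 1 n′) (f 2 n′) k ≡ cycle₄ b d a c k
    top-right-square = cycle₄-cong
      (trans (proj₁ (top-rows n′ ≤-refl)) (cycle₄-period b c d a 4∣s))
      (trans (proj₂ (top-rows n′ ≤-refl)) (cycle₄-period d a b c 4∣s))
      (trans (proj₁ (top-rows s (n≤1+n n′))) (cycle₄-period a b c d 4∣s))
      (trans (proj₂ (top-rows s (n≤1+n n′))) (cycle₄-period c d a b 4∣s))

lemma2p1 : (m n : ℕ) → 3 ≤ m → 3 ≤ n → ¬ (2 ∣ m)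
    → (∃ λ n' → 3 ≤ n' × HasDynamicColoring 3 4 m n')
    → (∀ m' → 3 ≤ m' → m' < m → ¬ (2 ∣ m') → ∀ n' → 3 ≤ n' → ¬ HasDynamicColoring 3 4 m' n')
    → (f : Coloring 4) → IsDynamicColoring 3 4 m n f
    → (f 1 1 ≢ f 1 2 × f 1 1 ≢ f 2 1 × f 1 1 ≢ f 2 2
       × f 1 2 ≢ f 2 1 × f 1 2 ≢ f 2 2 × f 2 1 ≢ f 2 2)
    × (∀ j → 1 ≤ j → j ≤ n → f 1 j ≡ cyc4 (f 1 1) (f 1 2) (f 2 1) (f 2 2) j)
    × (∀ j → 1 ≤ j → j ≤ n → f 2 j ≡ cyc4 (f 2 1) (f 2 2) (f 1 1) (f 1 2) j)
    × (∀ i → 1 ≤ i → i ≤ m → f i 1 ≡ cyc4 (f 1 1) (f 2 1) (f 1 2) (f 2 2) i)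
    × (∀ i → 1 ≤ i → i ≤ m → f i 2 ≡ cyc4 (f 1 2) (f 2 2) (f 1 1) (f 2 1) i)
    × n % 4 ≡ 2
    × (∀ i → 1 ≤ i → i ≤ m → f i (n ∸ 1) ≡ f i 1 × f i n ≡ f i 2)
lemma2p1 (suc (suc t)) (suc (suc s)) (s≤s (s≤s _)) (s≤s (s≤s _)) m-odd _ _ f dyn =
  pairwise-distinct corner-square-distinct
  , (λ j 1≤j j≤n → proj₁ (strip-cyc4 top-strip j 1≤j j≤n))
  , (λ j 1≤j j≤n → proj₂ (strip-cyc4 top-strip j 1≤j j≤n))
  , (λ i 1≤i i≤m → proj₁ (strip-cyc4 left-strip i 1≤i i≤m))
  , (λ i 1≤i i≤m → proj₂ (strip-cyc4 left-strip i 1≤i i≤m))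
  , width≡2
  , 4∣s⇒last-columns-copy 4∣s
  where
  open Grid dyn

  pairwise-distinct : ∀ {x y z w : Fin 4} → Unique (x ∷ y ∷ z ∷ w ∷ []) →
                      x ≢ y × x ≢ z × x ≢ w × y ≢ z × y ≢ w × z ≢ w
  pairwise-distinct ((x≢y ∷ x≢z ∷ x≢w ∷ []) ∷ (y≢z ∷ y≢w ∷ []) ∷ (z≢w ∷ []) ∷ [] ∷ []) =
    x≢y , x≢z , x≢w , y≢z , y≢w , z≢w

  4∣s : 4 ∣ s
  4∣s = odd-height⇒4∣s (m-odd ∘ ∣m∣n⇒∣m+n (divides 1 refl))

  width≡2 : (2 + s) % 4 ≡ 2
  width≡2 with 4∣s
  ... | divides q s≡q*4 = trans (cong (λ x → (2 + x) % 4) s≡q*4) ([m+kn]%n≡m%n 2 q 4)
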